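{- The relation $\{(G,F) : F\to_0 G \text{ or } F\to_{\mathcal I} G\}$, i.e. the reverse of $\to_0\cup\to_{\mathcal I}$, is well-founded on formulas.
   Context: Terms and formulas are those of first-order logic extended by Hilbert's $\varepsilon$-binder. The syntax has: - individual variables; - formula variables; - function and predicate symbols; - connectives; - for an individual variable $x$ and a formula $F$: the term $\varepsilon x.\,F$ and the formulas $\exists x.\,F$ and $\forall x.\,F$, each binding $x$. Formulas are identified modulo renaming of bound variables. Substitution is capture-avoiding. For $Q\in\{\exists,\forall\}$, write $\neg^{\forall}$ for $\neg$ and $\neg^{\exists}$ for the empty string. The relation $F\to G$ holds iff $G$ is obtained from $F$ by replacing one occurrence of a subformula $Qx.\,A$ by $A\{x\mapsto\varepsilon x.\,\neg^Q A\}$. The occurrence may lie anywhere in $F$. The relation $\to_0$ is the restriction of $\to$ to steps where $x$ does not occur free in $A$ (vacuous quantifier). The relation $\to_{\mathcal I}$ is the restriction of $\to$ to innermost steps, i.e. steps where $A$ contains no occurrence of a quantifier. A relation $R$ is well-founded iff every non-empty class $B$ has an element $a$ with no $a'\in B$ satisfying $a'Ra$. -}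

module Defs where

open import Data.Nat using (ℕ; zero; suc; _≡ᵇ_)
open import Data.List using (List; []; _∷_)
open import Data.Bool using (Bool; true; false; _∨_; _∧_)
open import Data.Sum using (_⊎_)
open import Relation.Binary.PropositionalEquality using (_≡_)

-- Individual variables are de Bruijn indices, so formulas are
-- automatically identified modulo renaming of bound variables.
-- εx.F, ∃x.F, ∀x.F bind index 0 in F.

data Quant : Set where
  ∃q ∀q : Quant

mutual
  data Term : Set where
    var : ℕ → Term
    fun : ℕ → List Term → Term
    eps : Formula → Term

  data Formula : Set where
    fvar  : ℕ → Formula
    pred  : ℕ → List Term → Formula
    ⊤f ⊥f : Formula
    ¬f    : Formula → Formula
    _∧f_ _∨f_ _⇒f_ _⇔f_ : Formula → Formula → Formula
    quant : Quant → Formula → Formula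

ext : (ℕ → ℕ) → ℕ → ℕ
ext ρ zero    = zero
ext ρ (suc n) = suc (ρ n)

mutual
  renT : (ℕ → ℕ) → Term → Term
  renT ρ (var n)    = var (ρ n)
  renT ρ (fun f ts) = fun f (renTs ρ ts)
  renT ρ (eps A)    = eps (renF (ext ρ) A)

  renTs : (ℕ → ℕ) → List Term → List Term
  renTs ρ []       = []
  renTs ρ (t ∷ ts) = renT ρ t ∷ renTs ρ ts

  renF : (ℕ → ℕ) → Formula → Formula
  renF ρ (fvar p)    = fvar p
  renF ρ (pred P ts) = pred P (renTs ρ ts)
  renF ρ ⊤f          = ⊤f
  renF ρ ⊥f          = ⊥f
  renF ρ (¬f A)      = ¬f (renF ρ A)
  renF ρ (A ∧f B)    = renF ρ A ∧f renF ρ B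
  renF ρ (A ∨f B)    = renF ρ A ∨f renF ρ B
  renF ρ (A ⇒f B)    = renF ρ A ⇒f renF ρ B
  renF ρ (A ⇔f B)    = renF ρ A ⇔f renF ρ B
  renF ρ (quant Q A) = quant Q (renF (ext ρ) A)

exts : (ℕ → Term) → ℕ → Term
exts σ zero    = var zero
exts σ (suc n) = renT suc (σ n)

mutual
  subT : (ℕ → Term) → Term → Term
  subT σ (var n)    = σ n
  subT σ (fun f ts) = fun f (subTs σ ts)
  subT σ (eps A)    = eps (subF (exts σ) A)

  subTs : (ℕ → Term) → List Term → List Term
  subTs σ []       = []
  subTs σ (t ∷ ts) = subT σ t ∷ subTs σ ts

  subF : (ℕ → Term) → Formula → Formula
  subF σ (fvar p)    = fvar p
  subF σ (pred P ts) = pred P (subTs σ ts)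
  subF σ ⊤f          = ⊤f
  subF σ ⊥f          = ⊥f
  subF σ (¬f A)      = ¬f (subF σ A)
  subF σ (A ∧f B)    = subF σ A ∧f subF σ B
  subF σ (A ∨f B)    = subF σ A ∨f subF σ B
  subF σ (A ⇒f B)    = subF σ A ⇒f subF σ B
  subF σ (A ⇔f B)    = subF σ A ⇔f subF σ B
  subF σ (quant Q A) = quant Q (subF (exts σ) A)

sub0 : Term → ℕ → Term
sub0 t zero    = t
sub0 t (suc n) = var n

-- A{x ↦ t} where x is the variable bound in Qx.A
_[_] : Formula → Term → Formula
A [ t ] = subF (sub0 t) A

negQ : Quant → Formula → Formula
negQ ∃q A = A
negQ ∀q A = ¬f A

mutual
  freeT : ℕ → Term → Bool
  freeT n (var m)    = n ≡ᵇ m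
  freeT n (fun f ts) = freeTs n ts
  freeT n (eps A)    = freeF (suc n) A

  freeTs : ℕ → List Term → Bool
  freeTs n []       = false
  freeTs n (t ∷ ts) = freeT n t ∨ freeTs n ts

  freeF : ℕ → Formula → Bool
  freeF n (fvar p)    = false
  freeF n (pred P ts) = freeTs n ts
  freeF n ⊤f          = false
  freeF n ⊥f          = false
  freeF n (¬f A)      = freeF n A
  freeF n (A ∧f B)    = freeF n A ∨ freeF n B
  freeF n (A ∨f B)    = freeF n A ∨ freeF n B
  freeF n (A ⇒f B)    = freeF n A ∨ freeF n B
  freeF n (A ⇔f B)    = freeF n A ∨ freeF n B
  freeF n (quant Q A) = freeF (suc n) A

mutual
  qfreeT : Term → Bool
  qfreeT (var m)    = true
  qfreeT (fun f ts) = qfreeTs ts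
  qfreeT (eps A)    = qfreeF A

  qfreeTs : List Term → Bool
  qfreeTs []       = true
  qfreeTs (t ∷ ts) = qfreeT t ∧ qfreeTs ts

  qfreeF : Formula → Bool
  qfreeF (fvar p)    = true
  qfreeF (pred P ts) = qfreeTs ts
  qfreeF ⊤f          = true
  qfreeF ⊥f          = true
  qfreeF (¬f A)      = qfreeF A
  qfreeF (A ∧f B)    = qfreeF A ∧ qfreeF B
  qfreeF (A ∨f B)    = qfreeF A ∧ qfreeF B
  qfreeF (A ⇒f B)    = qfreeF A ∧ qfreeF B
  qfreeF (A ⇔f B)    = qfreeF A ∧ qfreeF B
  qfreeF (quant Q A) = false

-- One-step ε-elimination at an arbitrary position (inside formulas and
-- inside terms, incl. ε-terms), restricted by a side condition C Q A on
-- the redex Qx.A.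
Cond : Set₁
Cond = Quant → Formula → Set

mutual
  data StepT (C : Cond) : Term → Term → Set where
    fun-arg  : ∀ {f ts us} → StepTs C ts us → StepT C (fun f ts) (fun f us)
    eps-body : ∀ {A B} → StepF C A B → StepT C (eps A) (eps B)

  data StepTs (C : Cond) : List Term → List Term → Set where
    here  : ∀ {t u ts} → StepT C t u → StepTs C (t ∷ ts) (u ∷ ts)
    there : ∀ {t ts us} → StepTs C ts us → StepTs C (t ∷ ts) (t ∷ us)

  data StepF (C : Cond) : Formula → Formula → Set where
    root     : ∀ {Q A} → C Q A →
               StepF C (quant Q A) (A [ eps (negQ Q A) ])
    pred-arg : ∀ {P ts us} → StepTs C ts us → StepF C (pred P ts) (pred P us)
    ¬-cong   : ∀ {A A'} → StepF C A A' → StepF C (¬f A) (¬f A')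
    ∧ˡ : ∀ {A A' B} → StepF C A A' → StepF C (A ∧f B) (A' ∧f B)
    ∧ʳ : ∀ {A B B'} → StepF C B B' → StepF C (A ∧f B) (A ∧f B')
    ∨ˡ : ∀ {A A' B} → StepF C A A' → StepF C (A ∨f B) (A' ∨f B)
    ∨ʳ : ∀ {A B B'} → StepF C B B' → StepF C (A ∨f B) (A ∨f B')
    ⇒ˡ : ∀ {A A' B} → StepF C A A' → StepF C (A ⇒f B) (A' ⇒f B)
    ⇒ʳ : ∀ {A B B'} → StepF C B B' → StepF C (A ⇒f B) (A ⇒f B')
    ⇔ˡ : ∀ {A A' B} → StepF C A A' → StepF C (A ⇔f B) (A' ⇔f B)
    ⇔ʳ : ∀ {A B B'} → StepF C B B' → StepF C (A ⇔f B) (A ⇔f B')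
    quant-cong : ∀ {Q A A'} → StepF C A A' → StepF C (quant Q A) (quant Q A')

Vacuous : Cond
Vacuous Q A = freeF zero A ≡ false

Innermost : Cond
Innermost Q A = qfreeF A ≡ true

_⟶₀_ : Formula → Formula → Set
F ⟶₀ G = StepF Vacuous F G

_⟶ᵢ_ : Formula → Formula → Set
F ⟶ᵢ G = StepF Innermost F G

_⊏_ : Formula → Formula → Set
G ⊏ F = (F ⟶₀ G) ⊎ (F ⟶ᵢ G)

-- Count the occurrences of ∃ and ∀, including those inside ε-terms.  A step
-- removes the contracted quantifier and copies the ε-term εx.¬^Q A into A at
-- the free occurrences of x.  For a vacuous quantifier there are no such
-- occurrences, and for an innermost step the ε-term is quantifier-free, so in
-- both cases the count drops by exactly one, and ℕ is well-founded.
module Submission where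

open import Defs
open import Induction.WellFounded using (WellFounded; module Subrelation)
open import Data.Nat using (ℕ; zero; suc; _+_; _<_; s≤s)
open import Data.Nat.Properties using (+-monoˡ-<; +-monoʳ-<; ≤-refl; ≡⇒≡ᵇ)
open import Data.Nat.Induction using (<-wellFounded)
open import Data.List using (List; []; _∷_)
open import Data.Bool using (Bool; T; _∨_)
open import Data.Bool.Properties using (T-∨; T-∧; T-≡)
open import Data.Product using (_×_; _,_; proj₁; proj₂)
open import Data.Empty using (⊥-elim)
open import Data.Sum using (inj₁; inj₂)
open import Function.Bundles using (Equivalence)
open import Relation.Binary.PropositionalEquality using (_≡_; refl; cong; cong₂; subst; trans)
open import Relation.Binary.Construct.On using () renaming (wellFounded to on-wellFounded)

open Equivalence using (to; from)

mutual
  quantsT : Term → ℕ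
  quantsT (var n)    = 0
  quantsT (fun f ts) = quantsTs ts
  quantsT (eps A)    = quantsF A

  quantsTs : List Term → ℕ
  quantsTs []       = 0
  quantsTs (t ∷ ts) = quantsT t + quantsTs ts

  quantsF : Formula → ℕ
  quantsF (fvar p)    = 0
  quantsF (pred P ts) = quantsTs ts
  quantsF ⊤f          = 0
  quantsF ⊥f          = 0
  quantsF (¬f A)      = quantsF A
  quantsF (A ∧f B)    = quantsF A + quantsF B
  quantsF (A ∨f B)    = quantsF A + quantsF B
  quantsF (A ⇒f B)    = quantsF A + quantsF B
  quantsF (A ⇔f B)    = quantsF A + quantsF B
  quantsF (quant Q A) = suc (quantsF A)

mutual
  quantsT-renT : ∀ ρ t → quantsT (renT ρ t) ≡ quantsT t
  quantsT-renT ρ (var n)    = refl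
  quantsT-renT ρ (fun f ts) = quantsTs-renTs ρ ts
  quantsT-renT ρ (eps A)    = quantsF-renF (ext ρ) A

  quantsTs-renTs : ∀ ρ ts → quantsTs (renTs ρ ts) ≡ quantsTs ts
  quantsTs-renTs ρ []       = refl
  quantsTs-renTs ρ (t ∷ ts) = cong₂ _+_ (quantsT-renT ρ t) (quantsTs-renTs ρ ts)

  quantsF-renF : ∀ ρ A → quantsF (renF ρ A) ≡ quantsF A
  quantsF-renF ρ (fvar p)    = refl
  quantsF-renF ρ (pred P ts) = quantsTs-renTs ρ ts
  quantsF-renF ρ ⊤f          = refl
  quantsF-renF ρ ⊥f          = refl
  quantsF-renF ρ (¬f A)      = quantsF-renF ρ A
  quantsF-renF ρ (A ∧f B)    = cong₂ _+_ (quantsF-renF ρ A) (quantsF-renF ρ B)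
  quantsF-renF ρ (A ∨f B)    = cong₂ _+_ (quantsF-renF ρ A) (quantsF-renF ρ B)
  quantsF-renF ρ (A ⇒f B)    = cong₂ _+_ (quantsF-renF ρ A) (quantsF-renF ρ B)
  quantsF-renF ρ (A ⇔f B)    = cong₂ _+_ (quantsF-renF ρ A) (quantsF-renF ρ B)
  quantsF-renF ρ (quant Q A) = cong suc (quantsF-renF (ext ρ) A)

record QuantFreeOn (P : ℕ → Bool) (σ : ℕ → Term) : Set where
  constructor quantFreeOn
  field quantFreeAt : ∀ k → T (P k) → quantsT (σ k) ≡ 0

open QuantFreeOn

QuantFreeOn-∨ˡ : ∀ (P R : ℕ → Bool) {σ} → QuantFreeOn (λ k → P k ∨ R k) σ → QuantFreeOn P σ
QuantFreeOn-∨ˡ P R H = quantFreeOn λ k p → quantFreeAt H k (from (T-∨ {P k} {R k}) (inj₁ p))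

QuantFreeOn-∨ʳ : ∀ (P R : ℕ → Bool) {σ} → QuantFreeOn (λ k → P k ∨ R k) σ → QuantFreeOn R σ
QuantFreeOn-∨ʳ P R H = quantFreeOn λ k r → quantFreeAt H k (from (T-∨ {P k} {R k}) (inj₂ r))

QuantFreeOn-exts : ∀ {P : ℕ → Bool} {σ} → QuantFreeOn (λ k → P (suc k)) σ → QuantFreeOn P (exts σ)
QuantFreeOn-exts {P} {σ} H = quantFreeOn extended
  where
  extended : ∀ k → T (P k) → quantsT (exts σ k) ≡ 0
  extended zero    p = refl
  extended (suc k) p = trans (quantsT-renT suc (σ k)) (quantFreeAt H k p)

mutual
  quantsT-subT : ∀ σ t → QuantFreeOn (λ k → freeT k t) σ → quantsT (subT σ t) ≡ quantsT t
  quantsT-subT σ (var n)    H = quantFreeAt H n (≡⇒≡ᵇ n n refl)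
  quantsT-subT σ (fun f ts) H = quantsTs-subTs σ ts H
  quantsT-subT σ (eps A)    H = quantsF-subF (exts σ) A (QuantFreeOn-exts H)

  quantsTs-subTs : ∀ σ ts → QuantFreeOn (λ k → freeTs k ts) σ →
                   quantsTs (subTs σ ts) ≡ quantsTs ts
  quantsTs-subTs σ []       H = refl
  quantsTs-subTs σ (t ∷ ts) H =
    cong₂ _+_ (quantsT-subT σ t (QuantFreeOn-∨ˡ (λ k → freeT k t) (λ k → freeTs k ts) H))
              (quantsTs-subTs σ ts (QuantFreeOn-∨ʳ (λ k → freeT k t) (λ k → freeTs k ts) H))

  quantsF-subF : ∀ σ A → QuantFreeOn (λ k → freeF k A) σ → quantsF (subF σ A) ≡ quantsF A
  quantsF-subF σ (fvar p)    H = refl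
  quantsF-subF σ (pred P ts) H = quantsTs-subTs σ ts H
  quantsF-subF σ ⊤f          H = refl
  quantsF-subF σ ⊥f          H = refl
  quantsF-subF σ (¬f A)      H = quantsF-subF σ A H
  quantsF-subF σ (A ∧f B)    H = quantsF-subF₂ σ A B H
  quantsF-subF σ (A ∨f B)    H = quantsF-subF₂ σ A B H
  quantsF-subF σ (A ⇒f B)    H = quantsF-subF₂ σ A B H
  quantsF-subF σ (A ⇔f B)    H = quantsF-subF₂ σ A B H
  quantsF-subF σ (quant Q A) H = cong suc (quantsF-subF (exts σ) A (QuantFreeOn-exts H))

  quantsF-subF₂ : ∀ σ A B → QuantFreeOn (λ k → freeF k A ∨ freeF k B) σ →
                  quantsF (subF σ A) + quantsF (subF σ B) ≡ quantsF A + quantsF B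
  quantsF-subF₂ σ A B H =
    cong₂ _+_ (quantsF-subF σ A (QuantFreeOn-∨ˡ (λ k → freeF k A) (λ k → freeF k B) H))
              (quantsF-subF σ B (QuantFreeOn-∨ʳ (λ k → freeF k A) (λ k → freeF k B) H))

mutual
  qfreeT⇒quantsT≡0 : ∀ t → T (qfreeT t) → quantsT t ≡ 0
  qfreeT⇒quantsT≡0 (var m)    q = refl
  qfreeT⇒quantsT≡0 (fun f ts) q = qfreeTs⇒quantsTs≡0 ts q
  qfreeT⇒quantsT≡0 (eps A)    q = qfreeF⇒quantsF≡0 A q

  qfreeTs⇒quantsTs≡0 : ∀ ts → T (qfreeTs ts) → quantsTs ts ≡ 0
  qfreeTs⇒quantsTs≡0 []       q = refl
  qfreeTs⇒quantsTs≡0 (t ∷ ts) q = cong₂ _+_ (qfreeT⇒quantsT≡0 t (proj₁ (to T-∧ q)))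
                                            (qfreeTs⇒quantsTs≡0 ts (proj₂ (to T-∧ q)))

  qfreeF⇒quantsF≡0 : ∀ A → T (qfreeF A) → quantsF A ≡ 0
  qfreeF⇒quantsF≡0 (fvar p)    q = refl
  qfreeF⇒quantsF≡0 (pred P ts) q = qfreeTs⇒quantsTs≡0 ts q
  qfreeF⇒quantsF≡0 ⊤f          q = refl
  qfreeF⇒quantsF≡0 ⊥f          q = refl
  qfreeF⇒quantsF≡0 (¬f A)      q = qfreeF⇒quantsF≡0 A q
  qfreeF⇒quantsF≡0 (A ∧f B)    q = qfreeF₂⇒quantsF≡0 A B (to T-∧ q)
  qfreeF⇒quantsF≡0 (A ∨f B)    q = qfreeF₂⇒quantsF≡0 A B (to T-∧ q)
  qfreeF⇒quantsF≡0 (A ⇒f B)    q = qfreeF₂⇒quantsF≡0 A B (to T-∧ q)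
  qfreeF⇒quantsF≡0 (A ⇔f B)    q = qfreeF₂⇒quantsF≡0 A B (to T-∧ q)
  qfreeF⇒quantsF≡0 (quant Q A) ()

  qfreeF₂⇒quantsF≡0 : ∀ A B → T (qfreeF A) × T (qfreeF B) → quantsF A + quantsF B ≡ 0
  qfreeF₂⇒quantsF≡0 A B (qA , qB) = cong₂ _+_ (qfreeF⇒quantsF≡0 A qA) (qfreeF⇒quantsF≡0 B qB)

qfreeF-negQ : ∀ Q A → T (qfreeF A) → T (qfreeF (negQ Q A))
qfreeF-negQ ∃q A q = q
qfreeF-negQ ∀q A q = q

InstancePreservesQuants : Cond → Set
InstancePreservesQuants C = ∀ Q A → C Q A → quantsF (A [ eps (negQ Q A) ]) ≡ quantsF A

vacuous-preservesQuants : InstancePreservesQuants Vacuous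
vacuous-preservesQuants Q A notFree = quantsF-subF _ A (quantFreeOn noOccurrence)
  where
  noOccurrence : ∀ k → T (freeF k A) → quantsT (sub0 (eps (negQ Q A)) k) ≡ 0
  noOccurrence zero    free = ⊥-elim (subst T notFree free)
  noOccurrence (suc k) free = refl

innermost-preservesQuants : InstancePreservesQuants Innermost
innermost-preservesQuants Q A qfree = quantsF-subF _ A (quantFreeOn epsQuantFree)
  where
  epsQuantFree : ∀ k → T (freeF k A) → quantsT (sub0 (eps (negQ Q A)) k) ≡ 0
  epsQuantFree zero    free = qfreeF⇒quantsF≡0 (negQ Q A) (qfreeF-negQ Q A (from T-≡ qfree))
  epsQuantFree (suc k) free = refl

module StepDecreasesQuants (C : Cond) (preserves : InstancePreservesQuants C) where
  mutual
    stepT⇒quantsT< : ∀ {t u} → StepT C t u → quantsT u < quantsT t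
    stepT⇒quantsT< (fun-arg s)  = stepTs⇒quantsTs< s
    stepT⇒quantsT< (eps-body s) = stepF⇒quantsF< s

    stepTs⇒quantsTs< : ∀ {ts us} → StepTs C ts us → quantsTs us < quantsTs ts
    stepTs⇒quantsTs< (here {ts = ts} s) = +-monoˡ-< (quantsTs ts) (stepT⇒quantsT< s)
    stepTs⇒quantsTs< (there {t = t} s)  = +-monoʳ-< (quantsT t) (stepTs⇒quantsTs< s)

    stepF⇒quantsF< : ∀ {A B} → StepF C A B → quantsF B < quantsF A
    stepF⇒quantsF< (root {Q} {A} c) rewrite preserves Q A c = s≤s ≤-refl
    stepF⇒quantsF< (pred-arg s)     = stepTs⇒quantsTs< s
    stepF⇒quantsF< (¬-cong s)       = stepF⇒quantsF< s
    stepF⇒quantsF< (∧ˡ {B = B} s)   = +-monoˡ-< (quantsF B) (stepF⇒quantsF< s)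
    stepF⇒quantsF< (∧ʳ {A = A} s)   = +-monoʳ-< (quantsF A) (stepF⇒quantsF< s)
    stepF⇒quantsF< (∨ˡ {B = B} s)   = +-monoˡ-< (quantsF B) (stepF⇒quantsF< s)
    stepF⇒quantsF< (∨ʳ {A = A} s)   = +-monoʳ-< (quantsF A) (stepF⇒quantsF< s)
    stepF⇒quantsF< (⇒ˡ {B = B} s)   = +-monoˡ-< (quantsF B) (stepF⇒quantsF< s)
    stepF⇒quantsF< (⇒ʳ {A = A} s)   = +-monoʳ-< (quantsF A) (stepF⇒quantsF< s)
    stepF⇒quantsF< (⇔ˡ {B = B} s)   = +-monoˡ-< (quantsF B) (stepF⇒quantsF< s)
    stepF⇒quantsF< (⇔ʳ {A = A} s)   = +-monoʳ-< (quantsF A) (stepF⇒quantsF< s)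
    stepF⇒quantsF< (quant-cong s)   = s≤s (stepF⇒quantsF< s)

open StepDecreasesQuants using (stepF⇒quantsF<)

⊏⇒quantsF< : ∀ {G F} → G ⊏ F → quantsF G < quantsF F
⊏⇒quantsF< (inj₁ s) = stepF⇒quantsF< Vacuous vacuous-preservesQuants s
⊏⇒quantsF< (inj₂ s) = stepF⇒quantsF< Innermost innermost-preservesQuants s

corollary3p6 : WellFounded _⊏_
corollary3p6 = Subrelation.wellFounded ⊏⇒quantsF< (on-wellFounded quantsF <-wellFounded)
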